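{- $n(3,12,32)\le 162$; that is, there exists an $egr(162,3,12,32)$ graph (in fact a vertex-transitive one). Consequently, it is false that for $q=3$ and $g=12$ there is an $egr(2q^{(g-2)/2},q,g,(q-1)^{(g-2)/2}(q-2))=egr(486,3,12,32)$ graph which is extremal (i.e. of order $n(3,12,32)$).
   Context: All graphs are finite, simple (no loops or parallel edges) and connected. For integers $v,k,g,\lambda$, an $egr(v,k,g,\lambda)$ graph (edge-girth-regular graph) is a $k$-regular graph of girth $g$ on $v$ vertices such that every edge is contained in exactly $\lambda$ cycles of length $g$. $n(k,g,\lambda)$ denotes the smallest integer $v$ such that an $egr(v,k,g,\lambda)$ graph exists, and $n(k,g,\lambda)=\infty$ if no such graph exists. An $egr$ graph is called extremal if its order equals $n(k,g,\lambda)$. -}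

module Defs where

open import Data.Nat using (ℕ; zero; suc; _+_; _∸_; _≤_; _<_; _≤ᵇ_)
open import Data.Fin using (Fin; zero; suc; _≟_)
open import Data.Vec using (Vec; []; _∷_)
open import Data.Bool using (Bool; true; false; _∧_; not; if_then_else_)
open import Data.Product using (Σ; _×_; ∃; _,_)
open import Relation.Nullary using (¬_)
open import Relation.Nullary.Decidable using (⌊_⌋)
open import Relation.Binary.PropositionalEquality using (_≡_)
open import Function.Bundles using (_↔_; Inverse)

record Graph (n : ℕ) : Set where
  field
    adj    : Fin n → Fin n → Bool
    sym    : ∀ i j → adj i j ≡ adj j i
    irrefl : ∀ i → adj i i ≡ false
open Graph public

module _ {n : ℕ} (G : Graph n) where

  Edge : Fin n → Fin n → Set
  Edge i j = adj G i j ≡ true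

  data Walk : Fin n → Fin n → Set where
    here : ∀ {i} → Walk i i
    step : ∀ {i j k} → Edge i j → Walk j k → Walk i k

  Connected : Set
  Connected = ∀ i j → Walk i j

countFin : (n : ℕ) → (Fin n → Bool) → ℕ
countFin zero    p = 0
countFin (suc n) p = (if p zero then 1 else 0) + countFin n (λ i → p (suc i))

countVec : (n m : ℕ) → (Vec (Fin n) m → Bool) → ℕ
countVec n zero    p = if p [] then 1 else 0
countVec n (suc m) p = sumFin n (λ i → countVec n m (λ vs → p (i ∷ vs)))
  where
  sumFin : (n : ℕ) → (Fin n → ℕ) → ℕ
  sumFin zero    f = 0
  sumFin (suc n) f = f zero + sumFin n (λ i → f (suc i))

module _ {n : ℕ} (G : Graph n) where

  degree : Fin n → ℕ
  degree i = countFin n (adj G i)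

  Regular : ℕ → Set
  Regular k = ∀ i → degree i ≡ k

  notIn : ∀ {m} → Fin n → Vec (Fin n) m → Bool
  notIn x []       = true
  notIn x (y ∷ ys) = not ⌊ x ≟ y ⌋ ∧ notIn x ys

  distinct : ∀ {m} → Vec (Fin n) m → Bool
  distinct []       = true
  distinct (x ∷ xs) = notIn x xs ∧ distinct xs

  closedChain : ∀ {m} → Fin n → Vec (Fin n) m → Bool
  closedChain first []            = true
  closedChain first (x ∷ [])      = adj G x first
  closedChain first (x ∷ y ∷ ys)  = adj G x y ∧ closedChain first (y ∷ ys)

  isCycle : ∀ {m} → Vec (Fin n) m → Bool
  isCycle {m} []       = false
  isCycle {m} (x ∷ xs) = (3 ≤ᵇ m) ∧ distinct (x ∷ xs) ∧ closedChain x (x ∷ xs)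

  HasCycle : ℕ → Set
  HasCycle m = Σ (Vec (Fin n) m) λ v → isCycle v ≡ true

  Girth : ℕ → Set
  Girth g = HasCycle g × (∀ m → m < g → ¬ HasCycle m)

  -- Number of cycles of length g containing the edge {u,w}: each such cycle
  -- corresponds to exactly one cyclic sequence (u, w, v₂, …, v_{g-1}) starting
  -- with u and traversed from u towards w.
  cyclesThrough : ℕ → Fin n → Fin n → ℕ
  cyclesThrough g u w = countVec n (g ∸ 2) (λ vs → isCycle (u ∷ w ∷ vs))

  IsEGR : ℕ → ℕ → ℕ → Set
  IsEGR k g λ′ = Connected G × Regular k × Girth g
               × (∀ u w → Edge G u w → cyclesThrough g u w ≡ λ′)

  VertexTransitive : Set
  VertexTransitive = ∀ u w → Σ (Fin n ↔ Fin n) λ σ →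
    (∀ i j → adj G (Inverse.to σ i) (Inverse.to σ j) ≡ adj G i j)
    × Inverse.to σ u ≡ w

-- v ≤ n(k,g,λ): every egr(m,k,g,λ) graph has at least v vertices.
-- An egr(v,k,g,λ) graph is extremal iff additionally this holds.
OrderIsMinimal : ℕ → ℕ → ℕ → ℕ → Set
OrderIsMinimal v k g λ′ = ∀ m (H : Graph m) → IsEGR H k g λ′ → v ≤ m

Extremal : ∀ {v} → Graph v → ℕ → ℕ → ℕ → Set
Extremal {v} G k g λ′ = IsEGR G k g λ′ × OrderIsMinimal v k g λ′

-- The graph is the Cayley graph of ℤ₉ ⋊ ℤ₁₈, with (a , b)(c , d) = (a + 2ᵇ c , b + d), for the
-- connection set {(0 , ±1) , (1 , 9)}: nine 18-cycles a × ℤ₁₈ joined by the perfect matching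
-- (a , b) ~ (a + 2ᵇ , b + 9). Left translations are automorphisms, so the graph is
-- vertex-transitive, and every edge is carried onto one of the three edges at the identity.
-- A g-cycle through an edge u w is a path from w back to u through g − 2 fresh vertices, so the
-- number of such cycles is the number of closing paths found by a depth-first search from the
-- identity: 32 for g = 12 and none for 3 ≤ g < 12. As 162 < 486, an egr(486, 3, 12, 32) graph
-- cannot have the least possible order.
module Submission where

open import Defs
open import Data.Product using (Σ; _×_)
open import Relation.Nullary using (¬_)

open import Data.Bool using (Bool; true; false; _∧_; _∨_; not; if_then_else_)
open import Data.Bool.Properties using (∧-commutativeMonoid)
import Data.Bool.Properties as Bool
open import Data.Fin using (Fin; zero; suc; toℕ; _≟_)
open import Data.Fin.Permutation
  using (Permutation′; permutation; _⟨$⟩ʳ_; _⟨$⟩ˡ_; inverseˡ; inverseʳ; _∘ₚ_; flip)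
import Data.Fin.Permutation as Perm
open import Data.Fin.Properties using (all?; toℕ-injective)
open import Data.List using (List; []; _∷_)
import Data.List as List
import Data.List.Properties as List
open import Data.List.Membership.Propositional using (_∈_; _∉_)
open import Data.List.Membership.Propositional.Properties using (∈-map⁺; ∈-map⁻)
open import Data.List.Relation.Unary.All as All using (All)
open import Data.List.Relation.Unary.All.Properties using (All¬⇒¬Any)
open import Data.List.Relation.Unary.Any using (any?)
open import Data.List.Relation.Unary.Unique.Propositional using (Unique; _∷_)
open import Data.List.Relation.Unary.Unique.DecPropositional (_≟_ {162}) using (unique?)
open import Data.Nat using (ℕ; zero; suc; _+_; _*_; _^_; _∸_; _≤_; _<_; _≤ᵇ_; _≡ᵇ_; z≤n; s≤s)
open import Data.Nat.DivMod using (_%_; _/_; _mod_)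
open import Data.Nat.Induction using (<-wellFounded)
open import Data.Nat.ListAction using (sum)
open import Data.Nat.Properties using (+-0-commutativeMonoid; +-identityʳ; m≤m+n; <-≤-trans; <⇒≢; <⇒≱)
import Data.Nat.Properties as ℕ
open import Data.List.Membership.DecPropositional ℕ._≟_ using () renaming (_∈?_ to _∈ℕ?_)
open import Data.Product using (_,_; Σ-syntax)
open import Data.Sum using (_⊎_; inj₁; inj₂)
open import Data.Unit using (tt)
open import Data.Vec using (Vec; []; _∷_; map)
import Data.Vec as Vec
open import Function using (_∘_; mk⇔)
open import Function.Bundles using (Injection)
open import Function.Properties.Inverse using (↔⇒↣)
open import Induction.WellFounded using (Acc; acc)
open import Relation.Binary.PropositionalEquality as ≡
  using (_≡_; refl; trans; cong; cong₂; subst; subst₂; module ≡-Reasoning)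
open import Relation.Nullary using (Dec; yes; no; does; contradiction)
open import Relation.Nullary.Decidable
  using (⌊_⌋; True; toWitness; ¬?; _⊎-dec_; _×-dec_; dec-false; does-⇔)
open import Algebra.Properties.CommutativeMonoid.Sum +-0-commutativeMonoid
  using (sum-syntax; ∑-distrib-+; ∑-permute; sum-cong-≗; sum-replicate-zero; sum-remove)
open import Algebra.Solver.CommutativeMonoid ∧-commutativeMonoid using (solve; _⊕_; _⊜_; id)

open ≡-Reasoning

infix 4 _∈?_
_∈?_ : ∀ {n} (i : Fin n) (xs : List (Fin n)) → Dec (i ∈ xs)
i ∈? xs = any? (i ≟_) xs

∑-indicator : ∀ {n} (x : Fin n) (f : Fin n → ℕ) → ∑[ i < n ] (if does (i ≟ x) then f i else 0) ≡ f x
∑-indicator {suc n} zero    f = trans (cong (f zero +_) (sum-replicate-zero n)) (+-identityʳ (f zero))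
∑-indicator {suc n} (suc x) f = ∑-indicator x (f ∘ suc)

∑-∈ : ∀ {n} (xs : List (Fin n)) → Unique xs → (f : Fin n → ℕ) →
      ∑[ i < n ] (if does (i ∈? xs) then f i else 0) ≡ sum (List.map f xs)
∑-∈ {n} []       _            f = sum-replicate-zero n
∑-∈ {n} (x ∷ xs) (x∉xs ∷ xs!) f = begin
  ∑[ i < n ] (if does (i ≟ x) ∨ does (i ∈? xs) then f i else 0) ≡⟨ sum-cong-≗ split ⟩
  ∑[ i < n ] (at-x i + in-xs i)                                  ≡⟨ ∑-distrib-+ at-x in-xs ⟩
  ∑[ i < n ] at-x i + ∑[ i < n ] in-xs i                         ≡⟨ cong₂ _+_ (∑-indicator x f) (∑-∈ xs xs! f) ⟩
  f x + sum (List.map f xs)                                      ∎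
  where
  at-x in-xs : Fin n → ℕ
  at-x  i = if does (i ≟ x) then f i else 0
  in-xs i = if does (i ∈? xs) then f i else 0

  split : ∀ i → (if does (i ≟ x) ∨ does (i ∈? xs) then f i else 0) ≡ at-x i + in-xs i
  split i with i ≟ x
  ... | no _     = refl
  ... | yes refl rewrite dec-false (i ∈? xs) (All¬⇒¬Any x∉xs) = ≡.sym (+-identityʳ (f i))

term≤∑ : ∀ {n} (f : Fin n → ℕ) i → f i ≤ ∑[ j < n ] f j
term≤∑ {suc n} f i = subst (f i ≤_) (≡.sym (sum-remove {i = i} f)) (m≤m+n (f i) _)

countFin≡∑ : ∀ n (p : Fin n → Bool) → countFin n p ≡ ∑[ i < n ] (if p i then 1 else 0)
countFin≡∑ zero    p = refl
countFin≡∑ (suc n) p = cong ((if p zero then 1 else 0) +_) (countFin≡∑ n (p ∘ suc))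

_^ₚ_ : ∀ {n} → Permutation′ n → ℕ → Permutation′ n
π ^ₚ zero  = Perm.id
π ^ₚ suc k = π ∘ₚ (π ^ₚ k)

∧-trueˡ : ∀ a {b} → a ∧ b ≡ true → a ≡ true
∧-trueˡ true _ = refl

∧-trueʳ : ∀ a {b} → a ∧ b ≡ true → b ≡ true
∧-trueʳ true b≡true = b≡true

module _ {n : ℕ} (G : Graph n) where

  IsAutomorphism : Permutation′ n → Set
  IsAutomorphism π = ∀ i j → adj G (π ⟨$⟩ʳ i) (π ⟨$⟩ʳ j) ≡ adj G i j

  ∘ₚ-isAutomorphism : ∀ {π ρ} → IsAutomorphism π → IsAutomorphism ρ → IsAutomorphism (π ∘ₚ ρ)
  ∘ₚ-isAutomorphism {π} π-aut ρ-aut i j = trans (ρ-aut (π ⟨$⟩ʳ i) (π ⟨$⟩ʳ j)) (π-aut i j)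

  flip-isAutomorphism : ∀ {π} → IsAutomorphism π → IsAutomorphism (flip π)
  flip-isAutomorphism {π} π-aut i j = begin
    adj G (π ⟨$⟩ˡ i) (π ⟨$⟩ˡ j)                    ≡⟨ π-aut (π ⟨$⟩ˡ i) (π ⟨$⟩ˡ j) ⟨
    adj G (π ⟨$⟩ʳ (π ⟨$⟩ˡ i)) (π ⟨$⟩ʳ (π ⟨$⟩ˡ j))  ≡⟨ cong₂ (adj G) (inverseʳ π {i}) (inverseʳ π {j}) ⟩
    adj G i j                                      ∎

  ^ₚ-isAutomorphism : ∀ {π} → IsAutomorphism π → ∀ k → IsAutomorphism (π ^ₚ k)
  ^ₚ-isAutomorphism     π-aut zero    i j = refl
  ^ₚ-isAutomorphism {π} π-aut (suc k)     = ∘ₚ-isAutomorphism {π} {π ^ₚ k} π-aut (^ₚ-isAutomorphism π-aut k)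

  vertexTransitive-from-root : (r : Fin n) (τ : Fin n → Permutation′ n) →
                               (∀ v → IsAutomorphism (τ v)) → (∀ v → τ v ⟨$⟩ʳ r ≡ v) → VertexTransitive G
  vertexTransitive-from-root r τ τ-aut τ-r u w =
    flip (τ u) ∘ₚ τ w ,
    ∘ₚ-isAutomorphism {flip (τ u)} {τ w} (flip-isAutomorphism {τ u} (τ-aut u)) (τ-aut w) , (begin
      τ w ⟨$⟩ʳ (τ u ⟨$⟩ˡ u)             ≡⟨ cong (λ v → τ w ⟨$⟩ʳ (τ u ⟨$⟩ˡ v)) (τ-r u) ⟨
      τ w ⟨$⟩ʳ (τ u ⟨$⟩ˡ (τ u ⟨$⟩ʳ r))  ≡⟨ cong (τ w ⟨$⟩ʳ_) (inverseˡ (τ u)) ⟩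
      τ w ⟨$⟩ʳ r                        ≡⟨ τ-r w ⟩
      w                                 ∎)

  module _ {π : Permutation′ n} (π-aut : IsAutomorphism π) where

    private
      σ : Fin n → Fin n
      σ = π ⟨$⟩ʳ_

    ⌊≟⌋-permute : ∀ x y → ⌊ σ x ≟ σ y ⌋ ≡ ⌊ x ≟ y ⌋
    ⌊≟⌋-permute x y with x ≟ y | σ x ≟ σ y
    ... | yes _    | yes _     = refl
    ... | no _     | no _      = refl
    ... | yes refl | no σx≢σx  = contradiction refl σx≢σx
    ... | no x≢y   | yes σx≡σy = contradiction (Injection.injective (↔⇒↣ π) σx≡σy) x≢y

    notIn-permute : ∀ {m} x (ys : Vec (Fin n) m) → notIn G (σ x) (map σ ys) ≡ notIn G x ys
    notIn-permute x []       = refl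
    notIn-permute x (y ∷ ys) = cong₂ (λ b c → not b ∧ c) (⌊≟⌋-permute x y) (notIn-permute x ys)

    distinct-permute : ∀ {m} (xs : Vec (Fin n) m) → distinct G (map σ xs) ≡ distinct G xs
    distinct-permute []       = refl
    distinct-permute (x ∷ xs) = cong₂ _∧_ (notIn-permute x xs) (distinct-permute xs)

    closedChain-permute : ∀ {m} u (xs : Vec (Fin n) m) → closedChain G (σ u) (map σ xs) ≡ closedChain G u xs
    closedChain-permute u []           = refl
    closedChain-permute u (x ∷ [])     = π-aut x u
    closedChain-permute u (x ∷ y ∷ ys) = cong₂ _∧_ (π-aut x y) (closedChain-permute u (y ∷ ys))

    isCycle-permute : ∀ {m} (xs : Vec (Fin n) m) → isCycle G (map σ xs) ≡ isCycle G xs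
    isCycle-permute     []       = refl
    isCycle-permute {m} (x ∷ xs) =
      cong₂ (λ b c → (3 ≤ᵇ m) ∧ b ∧ c) (distinct-permute (x ∷ xs)) (closedChain-permute x (x ∷ xs))

  fresh : ∀ {j m} → Vec (Fin n) j → Vec (Fin n) m → Bool
  fresh visited []       = true
  fresh visited (k ∷ ks) = notIn G k visited ∧ fresh visited ks

  fresh-[] : ∀ {m} (ks : Vec (Fin n) m) → fresh [] ks ≡ true
  fresh-[] []       = refl
  fresh-[] (k ∷ ks) = fresh-[] ks

  ⌊≟⌋-sym : ∀ (x y : Fin n) → ⌊ x ≟ y ⌋ ≡ ⌊ y ≟ x ⌋
  ⌊≟⌋-sym x y with x ≟ y | y ≟ x
  ... | yes _    | yes _   = refl
  ... | no _     | no _    = refl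
  ... | yes refl | no x≢x  = contradiction refl x≢x
  ... | no x≢y   | yes y≡x = contradiction (≡.sym y≡x) x≢y

  fresh-∷ : ∀ {j m} k (visited : Vec (Fin n) j) (ks : Vec (Fin n) m) →
            fresh (k ∷ visited) ks ≡ notIn G k ks ∧ fresh visited ks
  fresh-∷ k visited []       = refl
  fresh-∷ k visited (x ∷ xs) rewrite fresh-∷ k visited xs | ⌊≟⌋-sym x k =
    solve 4 (λ a b c d → (a ⊕ b) ⊕ (c ⊕ d) ⊜ (a ⊕ c) ⊕ (b ⊕ d))
      refl (not ⌊ k ≟ x ⌋) (notIn G x visited) (notIn G k xs) (fresh visited xs)

  closes : ∀ {j m} → Fin n → Vec (Fin n) j → Fin n → Vec (Fin n) m → Bool
  closes u visited last []       = adj G last u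
  closes u visited last (k ∷ ks) = adj G last k ∧ notIn G k visited ∧ closes u (k ∷ visited) k ks

  closes≡ : ∀ {j m} u (visited : Vec (Fin n) j) last (ks : Vec (Fin n) m) →
            closes u visited last ks ≡ fresh visited ks ∧ distinct G ks ∧ closedChain G u (last ∷ ks)
  closes≡ u visited last []       = refl
  closes≡ u visited last (k ∷ ks) rewrite closes≡ u (k ∷ visited) k ks | fresh-∷ k visited ks =
    solve 6 (λ a b c d e f → a ⊕ b ⊕ ((c ⊕ d) ⊕ e ⊕ f) ⊜ (b ⊕ d) ⊕ (c ⊕ e) ⊕ (a ⊕ f))
      refl (adj G last k) (notIn G k visited) (notIn G k ks) (fresh visited ks) (distinct G ks)
      (closedChain G u (k ∷ ks))

  edge⇒⌊≟⌋≡false : ∀ {u w} → Edge G u w → ⌊ u ≟ w ⌋ ≡ false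
  edge⇒⌊≟⌋≡false {u} {w} uw with u ≟ w
  ... | no _     = refl
  ... | yes refl with () ← trans (≡.sym uw) (irrefl G u)

  isCycle≡closes : ∀ {u w m} (ks : Vec (Fin n) (suc m)) → Edge G u w →
                   isCycle G (u ∷ w ∷ ks) ≡ closes u (w ∷ u ∷ []) w ks
  isCycle≡closes {u} {w} ks uw
    rewrite closes≡ u (w ∷ u ∷ []) w ks | fresh-∷ w (u ∷ []) ks | fresh-∷ u [] ks | fresh-[] ks
          | uw | edge⇒⌊≟⌋≡false uw =
    solve 4 (λ a b c d → (a ⊕ b ⊕ c) ⊕ d ⊜ (b ⊕ a ⊕ id) ⊕ c ⊕ d)
      refl (notIn G u ks) (notIn G w ks) (distinct G ks) (closedChain G u (w ∷ ks))

  isCycle⇒edge : ∀ {u w m} (ks : Vec (Fin n) m) → isCycle G (u ∷ w ∷ ks) ≡ true → Edge G u w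
  isCycle⇒edge {u} {w} {m} ks cycle =
    ∧-trueˡ (adj G u w) (∧-trueʳ (distinct G (u ∷ w ∷ ks)) (∧-trueʳ (3 ≤ᵇ suc (suc m)) cycle))

  _++ʷ_ : ∀ {i j k} → Walk G i j → Walk G j k → Walk G i k
  here     ++ʷ q = q
  step e p ++ʷ q = step e (p ++ʷ q)

  reverseʷ : ∀ {i j} → Walk G i j → Walk G j i
  reverseʷ here               = here
  reverseʷ (step {i} {j} e p) = reverseʷ p ++ʷ step (trans (Graph.sym G j i) e) here

  connected-by-descent : (root : Fin n) (parent : Fin n → Fin n) (rank : Fin n → ℕ) →
                         (∀ i → i ≡ root ⊎ (Edge G i (parent i) × rank (parent i) < rank i)) →
                         Connected G
  connected-by-descent root parent rank descends i j = walk i ++ʷ reverseʷ (walk j)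
    where
    walk-from : ∀ i → Acc _<_ (rank i) → Walk G i root
    walk-from i (acc smaller) with descends i
    ... | inj₁ refl        = here
    ... | inj₂ (e , lower) = step e (walk-from (parent i) (smaller lower))

    walk : ∀ i → Walk G i root
    walk i = walk-from i (<-wellFounded (rank i))

¬extremal-above : ∀ {m v k g λ′} (G : Graph m) → IsEGR G k g λ′ → m < v →
                  ¬ (Σ (Graph v) λ H → Extremal H k g λ′)
¬extremal-above G egr m<v (H , _ , minimal) = <⇒≱ m<v (minimal _ G egr)

record AdjacencyList (n : ℕ) : Set where
  field
    neighbours  : Fin n → List (Fin n)
    unique      : ∀ i → Unique (neighbours i)
    irreflexive : ∀ i → i ∉ neighbours i
    symmetric   : ∀ i j → j ∈ neighbours i → i ∈ neighbours j

graph : ∀ {n} → AdjacencyList n → Graph n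
graph L = record
  { adj    = λ i j → does (j ∈? neighbours i)
  ; sym    = λ i j → does-⇔ (mk⇔ (symmetric i j) (symmetric j i)) (j ∈? neighbours i) (i ∈? neighbours j)
  ; irrefl = λ i → dec-false (i ∈? neighbours i) (irreflexive i)
  }
  where
  open AdjacencyList L

module _ {n : ℕ} (L : AdjacencyList n) where

  open AdjacencyList L

  degree≡length : ∀ i → degree (graph L) i ≡ List.length (neighbours i)
  degree≡length i = begin
    countFin n (λ j → does (j ∈? neighbours i))             ≡⟨ countFin≡∑ n _ ⟩
    ∑[ j < n ] (if does (j ∈? neighbours i) then 1 else 0)   ≡⟨ ∑-∈ (neighbours i) (unique i) _ ⟩
    sum (List.map (λ _ → 1) (neighbours i))                   ≡⟨ sum-ones (neighbours i) ⟩
    List.length (neighbours i)                                ∎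
    where
    sum-ones : ∀ (xs : List (Fin n)) → sum (List.map (λ _ → 1) xs) ≡ List.length xs
    sum-ones []       = refl
    sum-ones (x ∷ xs) = cong suc (sum-ones xs)

  preservesEdges⇒isAutomorphism : (π : Permutation′ n) →
    (∀ i → All (λ j → π ⟨$⟩ʳ j ∈ neighbours (π ⟨$⟩ʳ i)) (neighbours i)) →
    (∀ i → All (λ j → π ⟨$⟩ˡ j ∈ neighbours (π ⟨$⟩ˡ i)) (neighbours i)) →
    IsAutomorphism (graph L) π
  preservesEdges⇒isAutomorphism π forward backward i j =
    does-⇔ (mk⇔ reflect (All.lookup (forward i))) (π ⟨$⟩ʳ j ∈? _) (j ∈? neighbours i)
    where
    reflect : π ⟨$⟩ʳ j ∈ neighbours (π ⟨$⟩ʳ i) → j ∈ neighbours i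
    reflect πj∈ = subst₂ (λ a b → a ∈ neighbours b) (inverseˡ π) (inverseˡ π)
                         (All.lookup (backward (π ⟨$⟩ʳ i)) πj∈)

  edge⇒∈ : ∀ {i j} → Edge (graph L) i j → j ∈ neighbours i
  edge⇒∈ {i} {j} e  with j ∈? neighbours i
  edge⇒∈ {i} {j} e  | yes j∈ = j∈
  edge⇒∈ {i} {j} () | no _

-- The search runs on the codes toℕ of the vertices: ℕ arithmetic reduces natively,
-- Fin only in unary, which is far too slow for a search of this size.
closingPathsℕ : (ℕ → List ℕ) → ℕ → ℕ → List ℕ → ℕ → ℕ
closingPathsℕ nbrs u zero    visited last = if does (u ∈ℕ? nbrs last) then 1 else 0
closingPathsℕ nbrs u (suc m) visited last = sum (List.map extend (nbrs last))
  where
  extend : ℕ → ℕ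
  extend k = if not (does (k ∈ℕ? visited)) then closingPathsℕ nbrs u m (k ∷ visited) k else 0

codes : ∀ {n j} → Vec (Fin n) j → List ℕ
codes vs = List.map toℕ (Vec.toList vs)

does-∈?-toℕ : ∀ {n} (u : Fin n) xs → does (u ∈? xs) ≡ does (toℕ u ∈ℕ? List.map toℕ xs)
does-∈?-toℕ u xs = does-⇔ (mk⇔ (∈-map⁺ toℕ) reflect) (u ∈? xs) (toℕ u ∈ℕ? List.map toℕ xs)
  where
  reflect : toℕ u ∈ List.map toℕ xs → u ∈ xs
  reflect u∈ with ∈-map⁻ toℕ u∈
  ... | v , v∈xs , u≡v rewrite toℕ-injective u≡v = v∈xs

notIn≡∉ℕ : ∀ {n j} (G : Graph n) k (vs : Vec (Fin n) j) → notIn G k vs ≡ not (does (toℕ k ∈ℕ? codes vs))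
notIn≡∉ℕ G k vs = trans (notIn≡∉ vs) (cong not (does-∈?-toℕ k (Vec.toList vs)))
  where
  notIn≡∉ : ∀ {j} (vs : Vec _ j) → notIn G k vs ≡ not (does (k ∈? Vec.toList vs))
  notIn≡∉ []       = refl
  notIn≡∉ (v ∷ vs) with k ≟ v
  ... | yes _ = refl
  ... | no _  = notIn≡∉ vs

-- countVec-suc holds for every n, but Defs sums over Fin n with a where-bound helper,
-- so the equation is only available by evaluation at a concrete n.
module Counting {n : ℕ}
  (countVec-suc : ∀ m (p : Vec (Fin n) (suc m) → Bool) →
                  countVec n (suc m) p ≡ ∑[ i < n ] countVec n m (λ vs → p (i ∷ vs)))
  where

  countVec-cong : ∀ m {p q : Vec (Fin n) m → Bool} → (∀ vs → p vs ≡ q vs) → countVec n m p ≡ countVec n m q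
  countVec-cong zero            p≗q = cong (λ b → if b then 1 else 0) (p≗q [])
  countVec-cong (suc m) {p} {q} p≗q = begin
    countVec n (suc m) p                          ≡⟨ countVec-suc m p ⟩
    ∑[ i < n ] countVec n m (λ vs → p (i ∷ vs))   ≡⟨ sum-cong-≗ (λ i → countVec-cong m (λ vs → p≗q (i ∷ vs))) ⟩
    ∑[ i < n ] countVec n m (λ vs → q (i ∷ vs))   ≡⟨ countVec-suc m q ⟨
    countVec n (suc m) q                          ∎

  countVec-false : ∀ m → countVec n m (λ _ → false) ≡ 0
  countVec-false zero    = refl
  countVec-false (suc m) =
    trans (countVec-suc m (λ _ → false))
          (trans (sum-cong-≗ {n} (λ _ → countVec-false m)) (sum-replicate-zero n))

  countVec-∧ : ∀ m b (p : Vec (Fin n) m → Bool) →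
               countVec n m (λ vs → b ∧ p vs) ≡ (if b then countVec n m p else 0)
  countVec-∧ m true  p = refl
  countVec-∧ m false p = countVec-false m

  countVec-pos : ∀ m (p : Vec (Fin n) m → Bool) vs → p vs ≡ true → 0 < countVec n m p
  countVec-pos zero    p []       pvs rewrite pvs = s≤s z≤n
  countVec-pos (suc m) p (v ∷ vs) pvs = subst (0 <_) (≡.sym (countVec-suc m p))
    (<-≤-trans (countVec-pos m (λ ws → p (v ∷ ws)) vs pvs) (term≤∑ (λ i → countVec n m (λ ws → p (i ∷ ws))) v))

  countVec-permute : ∀ m (π : Permutation′ n) (p : Vec (Fin n) m → Bool) →
                     countVec n m (p ∘ map (π ⟨$⟩ʳ_)) ≡ countVec n m p
  countVec-permute zero    π p = refl
  countVec-permute (suc m) π p = begin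
    countVec n (suc m) (p ∘ map σ)
      ≡⟨ countVec-suc m (p ∘ map σ) ⟩
    ∑[ i < n ] countVec n m (λ vs → p (σ i ∷ map σ vs))
      ≡⟨ sum-cong-≗ (λ i → countVec-permute m π (λ vs → p (σ i ∷ vs))) ⟩
    ∑[ i < n ] countVec n m (λ vs → p (σ i ∷ vs))
      ≡⟨ ∑-permute (λ i → countVec n m (λ vs → p (i ∷ vs))) π ⟨
    ∑[ i < n ] countVec n m (λ vs → p (i ∷ vs))
      ≡⟨ countVec-suc m p ⟨
    countVec n (suc m) p
      ∎
    where
    σ : Fin n → Fin n
    σ = π ⟨$⟩ʳ_

  module _ (G : Graph n) where

    cyclesThrough-permute : ∀ {π} → IsAutomorphism G π → ∀ g u w →
                            cyclesThrough G g (π ⟨$⟩ʳ u) (π ⟨$⟩ʳ w) ≡ cyclesThrough G g u w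
    cyclesThrough-permute {π} π-aut g u w = begin
      countVec n (g ∸ 2) (λ vs → isCycle G (σ u ∷ σ w ∷ vs))
        ≡⟨ countVec-permute (g ∸ 2) π _ ⟨
      countVec n (g ∸ 2) (λ vs → isCycle G (σ u ∷ σ w ∷ map σ vs))
        ≡⟨ countVec-cong (g ∸ 2) (λ vs → isCycle-permute G {π} π-aut (u ∷ w ∷ vs)) ⟩
      countVec n (g ∸ 2) (λ vs → isCycle G (u ∷ w ∷ vs))
        ∎
      where
      σ : Fin n → Fin n
      σ = π ⟨$⟩ʳ_

    edge-to-root : VertexTransitive G → ∀ r {u w} → Edge G u w →
                   Σ[ w′ ∈ Fin n ] Edge G r w′ × (∀ g → cyclesThrough G g u w ≡ cyclesThrough G g r w′)
    edge-to-root vt r {u} {w} uw with vt r u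
    ... | π , π-aut , πr≡u = π ⟨$⟩ˡ w , r~w′ , same-count
      where
      π⁻¹w↦w : π ⟨$⟩ʳ (π ⟨$⟩ˡ w) ≡ w
      π⁻¹w↦w = inverseʳ π

      r~w′ : Edge G r (π ⟨$⟩ˡ w)
      r~w′ = begin
        adj G r (π ⟨$⟩ˡ w)                    ≡⟨ π-aut r (π ⟨$⟩ˡ w) ⟨
        adj G (π ⟨$⟩ʳ r) (π ⟨$⟩ʳ (π ⟨$⟩ˡ w))  ≡⟨ cong₂ (adj G) πr≡u π⁻¹w↦w ⟩
        adj G u w                             ≡⟨ uw ⟩
        true                                  ∎

      same-count : ∀ g → cyclesThrough G g u w ≡ cyclesThrough G g r (π ⟨$⟩ˡ w)
      same-count g = begin
        cyclesThrough G g u w                              ≡⟨ cong₂ (cyclesThrough G g) πr≡u π⁻¹w↦w ⟨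
        cyclesThrough G g (π ⟨$⟩ʳ r) (π ⟨$⟩ʳ (π ⟨$⟩ˡ w))  ≡⟨ cyclesThrough-permute {π} π-aut g r (π ⟨$⟩ˡ w) ⟩
        cyclesThrough G g r (π ⟨$⟩ˡ w)                     ∎

  module _ (L : AdjacencyList n) (neighboursℕ : ℕ → List ℕ)
           (coded : ∀ g → List.map toℕ (AdjacencyList.neighbours L g) ≡ neighboursℕ (toℕ g)) where

    open AdjacencyList L

    adj≡∈ℕ : ∀ i j → adj (graph L) i j ≡ does (toℕ j ∈ℕ? neighboursℕ (toℕ i))
    adj≡∈ℕ i j = trans (does-∈?-toℕ j (neighbours i)) (cong (λ ks → does (toℕ j ∈ℕ? ks)) (coded i))

    countVec-closes : ∀ {j} m u (visited : Vec (Fin n) j) last →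
                      countVec n m (closes (graph L) u visited last) ≡
                      closingPathsℕ neighboursℕ (toℕ u) m (codes visited) (toℕ last)
    countVec-closes zero    u visited last = cong (λ b → if b then 1 else 0) (adj≡∈ℕ last u)
    countVec-closes (suc m) u visited last = begin
      countVec n (suc m) (closes (graph L) u visited last)
        ≡⟨ countVec-suc m (closes (graph L) u visited last) ⟩
      ∑[ k < n ] countVec n m (λ ks → adj (graph L) last k ∧ continue k ks)
        ≡⟨ sum-cong-≗ peel ⟩
      ∑[ k < n ] (if does (k ∈? neighbours last) then extend k else 0)
        ≡⟨ ∑-∈ (neighbours last) (unique last) extend ⟩
      sum (List.map extend (neighbours last))
        ≡⟨ cong sum (List.map-cong extend≗ (neighbours last)) ⟩
      sum (List.map (extendℕ ∘ toℕ) (neighbours last))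
        ≡⟨ cong sum (List.map-∘ (neighbours last)) ⟩
      sum (List.map extendℕ (List.map toℕ (neighbours last)))
        ≡⟨ cong (sum ∘ List.map extendℕ) (coded last) ⟩
      sum (List.map extendℕ (neighboursℕ (toℕ last)))
        ∎
      where
      continue : Fin n → Vec (Fin n) m → Bool
      continue k ks = notIn (graph L) k visited ∧ closes (graph L) u (k ∷ visited) k ks

      extend : Fin n → ℕ
      extend k = if notIn (graph L) k visited then countVec n m (closes (graph L) u (k ∷ visited) k) else 0

      extendℕ : ℕ → ℕ
      extendℕ k = if not (does (k ∈ℕ? codes visited))
                  then closingPathsℕ neighboursℕ (toℕ u) m (k ∷ codes visited) k else 0

      peel : ∀ k → countVec n m (λ ks → adj (graph L) last k ∧ continue k ks) ≡
                   (if adj (graph L) last k then extend k else 0)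
      peel k = trans (countVec-∧ m _ _) (cong (λ c → if adj (graph L) last k then c else 0) (countVec-∧ m _ _))

      extend≗ : ∀ k → extend k ≡ extendℕ (toℕ k)
      extend≗ k = cong₂ (λ b c → if b then c else 0)
                        (notIn≡∉ℕ (graph L) k visited) (countVec-closes m u (k ∷ visited) k)

    cyclesThrough≡closingPathsℕ : ∀ {u w} m → Edge (graph L) u w →
      cyclesThrough (graph L) (3 + m) u w ≡
      closingPathsℕ neighboursℕ (toℕ u) (suc m) (toℕ w ∷ toℕ u ∷ []) (toℕ w)
    cyclesThrough≡closingPathsℕ {u} {w} m uw =
      trans (countVec-cong (suc m) (λ ks → isCycle≡closes (graph L) ks uw))
            (countVec-closes (suc m) u (w ∷ u ∷ []) w)

    cyclesThrough-from-root : VertexTransitive (graph L) → ∀ r g λ′ → 3 ≤ g →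
      All (λ w → closingPathsℕ neighboursℕ (toℕ r) (g ∸ 2) (toℕ w ∷ toℕ r ∷ []) (toℕ w) ≡ λ′) (neighbours r) →
      ∀ u w → Edge (graph L) u w → cyclesThrough (graph L) g u w ≡ λ′
    cyclesThrough-from-root vt r .(3 + m) λ′ (s≤s (s≤s (s≤s {n = m} _))) counts u w uw
      with edge-to-root (graph L) vt r uw
    ... | w′ , r~w′ , same = begin
      cyclesThrough (graph L) (3 + m) u w
        ≡⟨ same (3 + m) ⟩
      cyclesThrough (graph L) (3 + m) r w′
        ≡⟨ cyclesThrough≡closingPathsℕ m r~w′ ⟩
      closingPathsℕ neighboursℕ (toℕ r) (suc m) (toℕ w′ ∷ toℕ r ∷ []) (toℕ w′)
        ≡⟨ All.lookup counts (edge⇒∈ L r~w′) ⟩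
      λ′
        ∎

    noShortCycles-from-root : VertexTransitive (graph L) → ∀ r g →
      All (λ w → ∀ {m} → m < g ∸ 3 → closingPathsℕ neighboursℕ (toℕ r) (suc m) (toℕ w ∷ toℕ r ∷ []) (toℕ w) ≡ 0)
          (neighbours r) →
      ∀ m → m < g → ¬ HasCycle (graph L) m
    noShortCycles-from-root vt r g none _ _ ([] , ())
    noShortCycles-from-root vt r g none _ _ (_ ∷ [] , ())
    noShortCycles-from-root vt r g none _ _ (_ ∷ _ ∷ [] , ())
    noShortCycles-from-root vt r g none (suc (suc (suc m))) m<g (u ∷ w ∷ ks , cycle)
      with edge-to-root (graph L) vt r (isCycle⇒edge (graph L) {u} {w} ks cycle)
    ... | w′ , r~w′ , same = <⇒≢ positive (≡.sym vanishing)
      where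
      positive : 0 < cyclesThrough (graph L) (3 + m) u w
      positive = countVec-pos (suc m) (λ vs → isCycle (graph L) (u ∷ w ∷ vs)) ks cycle

      vanishing : cyclesThrough (graph L) (3 + m) u w ≡ 0
      vanishing = begin
        cyclesThrough (graph L) (3 + m) u w
          ≡⟨ same (3 + m) ⟩
        cyclesThrough (graph L) (3 + m) r w′
          ≡⟨ cyclesThrough≡closingPathsℕ m r~w′ ⟩
        closingPathsℕ neighboursℕ (toℕ r) (suc m) (toℕ w′ ∷ toℕ r ∷ []) (toℕ w′)
          ≡⟨ All.lookup none (edge⇒∈ L r~w′) (ℕ.∸-monoˡ-< m<g (m≤m+n 3 m)) ⟩
        0
          ∎

-- (a , b) ∈ ℤ₉ × ℤ₁₈ is coded as a + 9 b.
code : ℕ → ℕ → ℕ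
code a b = a % 9 + 9 * (b % 18)

-- (a , b)(c , d) = (a + 2ᵇ c , b + d), well defined since 2 has order 6 modulo 9.
_∙_ : ℕ → ℕ → ℕ
g ∙ h = code (g % 9 + 2 ^ (g / 9) * (h % 9)) (g / 9 + h / 9)

⟨_,_⟩ : ℕ → ℕ → Fin 162
⟨ a , b ⟩ = code a b mod 162

_·_ : Fin 162 → Fin 162 → Fin 162
g · h = (toℕ g ∙ toℕ h) mod 162

neighboursℕ : ℕ → List ℕ
neighboursℕ g = g ∙ code 0 1 ∷ g ∙ code 0 17 ∷ g ∙ code 1 9 ∷ []

cayley : AdjacencyList 162
cayley = record
  { neighbours  = neighbours
  ; unique      = toWitness {a? = all? λ g → unique? (neighbours g)} tt
  ; irreflexive = toWitness {a? = all? λ g → ¬? (g ∈? neighbours g)} tt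
  ; symmetric   = λ g h → All.lookup (toWitness {a? = all? symmetric?} tt g)
  }
  where
  neighbours : Fin 162 → List (Fin 162)
  neighbours g = g · ⟨ 0 , 1 ⟩ ∷ g · ⟨ 0 , 17 ⟩ ∷ g · ⟨ 1 , 9 ⟩ ∷ []

  symmetric? : ∀ g → Dec (All (λ h → g ∈ neighbours h) (neighbours g))
  symmetric? g = All.all? (λ h → g ∈? neighbours h) (neighbours g)

open AdjacencyList cayley using (neighbours)

coded : ∀ g → List.map toℕ (neighbours g) ≡ neighboursℕ (toℕ g)
coded = toWitness {a? = all? λ g → List.≡-dec ℕ._≟_ (List.map toℕ (neighbours g)) (neighboursℕ (toℕ g))} tt

ℤ₉-part ℤ₁₈-part : Fin 162 → ℕ
ℤ₉-part  g = toℕ g % 9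
ℤ₁₈-part g = toℕ g / 9

identity : Fin 162
identity = ⟨ 0 , 0 ⟩

translation : (g g⁻¹ : Fin 162) →
              {_ : True (all? λ h → g · (g⁻¹ · h) ≟ h)} → {_ : True (all? λ h → g⁻¹ · (g · h) ≟ h)} →
              Permutation′ 162
translation g g⁻¹ {left} {right} = permutation (g ·_) (g⁻¹ ·_) (toWitness left) (toWitness right)

x z : Permutation′ 162
x = translation ⟨ 1 , 0 ⟩ ⟨ 8 , 0 ⟩
z = translation ⟨ 0 , 1 ⟩ ⟨ 0 , 17 ⟩

preservesEdges? : (f : Fin 162 → Fin 162) → Dec (∀ g → All (λ h → f h ∈ neighbours (f g)) (neighbours g))
preservesEdges? f = all? λ g → mapsInto (neighbours g) (neighbours (f g))
  where
  mapsInto : ∀ hs ks → Dec (All (λ h → f h ∈ ks) hs)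
  mapsInto hs ks = All.all? (λ h → f h ∈? ks) hs

x-isAutomorphism : IsAutomorphism (graph cayley) x
x-isAutomorphism = preservesEdges⇒isAutomorphism cayley x
  (toWitness {a? = preservesEdges? (x ⟨$⟩ʳ_)} tt) (toWitness {a? = preservesEdges? (x ⟨$⟩ˡ_)} tt)

z-isAutomorphism : IsAutomorphism (graph cayley) z
z-isAutomorphism = preservesEdges⇒isAutomorphism cayley z
  (toWitness {a? = preservesEdges? (z ⟨$⟩ʳ_)} tt) (toWitness {a? = preservesEdges? (z ⟨$⟩ˡ_)} tt)

-- τ g is left multiplication by g = (a , b) = xᵃ zᵇ.
τ : Fin 162 → Permutation′ 162
τ g = (z ^ₚ ℤ₁₈-part g) ∘ₚ (x ^ₚ ℤ₉-part g)

vertexTransitive₁₆₂ : VertexTransitive (graph cayley)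
vertexTransitive₁₆₂ = vertexTransitive-from-root (graph cayley) identity τ
  (λ g → ∘ₚ-isAutomorphism (graph cayley) {z ^ₚ ℤ₁₈-part g} {x ^ₚ ℤ₉-part g}
           (^ₚ-isAutomorphism (graph cayley) {z} z-isAutomorphism (ℤ₁₈-part g))
           (^ₚ-isAutomorphism (graph cayley) {x} x-isAutomorphism (ℤ₉-part g)))
  (toWitness {a? = all? λ g → τ g ⟨$⟩ʳ identity ≟ g} tt)

-- Walk down the 18-cycle from (a , b) to (a , 0), then take the chord to (a + 1 , 9);
-- rank counts the steps still needed to reach the identity.
parent : Fin 162 → Fin 162
parent g = if ℤ₁₈-part g ≡ᵇ 0 then g · ⟨ 1 , 9 ⟩ else g · ⟨ 0 , 17 ⟩

rank : Fin 162 → ℕ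
rank g = ℤ₁₈-part g + 18 * ((9 ∸ ℤ₉-part g) % 9)

connected₁₆₂ : Connected (graph cayley)
connected₁₆₂ = connected-by-descent (graph cayley) identity parent rank (toWitness {a? = all? descends?} tt)
  where
  descends? : ∀ g → Dec (g ≡ identity ⊎ (Edge (graph cayley) g (parent g) × rank (parent g) < rank g))
  descends? g = (g ≟ identity) ⊎-dec
                ((adj (graph cayley) g (parent g) Bool.≟ true) ×-dec (rank (parent g) ℕ.<? rank g))

countVec₁₆₂-suc : ∀ m (p : Vec (Fin 162) (suc m) → Bool) →
                  countVec 162 (suc m) p ≡ ∑[ i < 162 ] countVec 162 m (λ vs → p (i ∷ vs))
countVec₁₆₂-suc m p = refl

open Counting countVec₁₆₂-suc

twelveCycle : Vec (Fin 162) 12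
twelveCycle = ⟨ 0 , 0 ⟩ ∷ ⟨ 0 , 1 ⟩ ∷ ⟨ 0 , 2 ⟩ ∷ ⟨ 0 , 3 ⟩ ∷ ⟨ 0 , 4 ⟩ ∷ ⟨ 0 , 5 ⟩ ∷
              ⟨ 5 , 14 ⟩ ∷ ⟨ 5 , 15 ⟩ ∷ ⟨ 5 , 16 ⟩ ∷ ⟨ 5 , 17 ⟩ ∷ ⟨ 1 , 8 ⟩ ∷ ⟨ 1 , 9 ⟩ ∷ []

girth₁₆₂ : Girth (graph cayley) 12
girth₁₆₂ = (twelveCycle , refl) ,
  noShortCycles-from-root cayley neighboursℕ coded vertexTransitive₁₆₂ identity 12
    (toWitness {a? = All.all? none? (neighbours identity)} tt)
  where
  none? : ∀ w → Dec (∀ {m} → m < 12 ∸ 3 →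
    closingPathsℕ neighboursℕ (toℕ identity) (suc m) (toℕ w ∷ toℕ identity ∷ []) (toℕ w) ≡ 0)
  none? w = ℕ.allUpTo?
    (λ m → closingPathsℕ neighboursℕ (toℕ identity) (suc m) (toℕ w ∷ toℕ identity ∷ []) (toℕ w) ℕ.≟ 0) (12 ∸ 3)

thirtyTwoCycles : ∀ u w → Edge (graph cayley) u w → cyclesThrough (graph cayley) 12 u w ≡ 32
thirtyTwoCycles = cyclesThrough-from-root cayley neighboursℕ coded vertexTransitive₁₆₂ identity 12 32
  (s≤s (s≤s (s≤s z≤n))) (toWitness {a? = All.all? counts? (neighbours identity)} tt)
  where
  counts? : ∀ w →
    Dec (closingPathsℕ neighboursℕ (toℕ identity) (12 ∸ 2) (toℕ w ∷ toℕ identity ∷ []) (toℕ w) ≡ 32)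
  counts? w = closingPathsℕ neighboursℕ (toℕ identity) (12 ∸ 2) (toℕ w ∷ toℕ identity ∷ []) (toℕ w) ℕ.≟ 32

mainTheorem9 : (Σ (Graph 162) λ G → IsEGR G 3 12 32 × VertexTransitive G)
                 × ¬ (Σ (Graph 486) λ G → Extremal G 3 12 32)
mainTheorem9 = (graph cayley , egr , vertexTransitive₁₆₂) , ¬extremal-above (graph cayley) egr 162<486
  where
  egr : IsEGR (graph cayley) 3 12 32
  egr = connected₁₆₂ , degree≡length cayley , girth₁₆₂ , thirtyTwoCycles

  162<486 : 162 < 486
  162<486 = toWitness {a? = 162 ℕ.<? 486} tt
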